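{- Let $m,n$ be integers with $3\leq m\leq n$. If at least one of $m$, $n$ is even, then $\chi_{lid}(C_m\times C_n)=3$.
   Context: $C_n$ denotes the cycle on $n$ vertices. A proper $k$-coloring of a graph $G$ is a map $f:V(G)\to\{1,\dots,k\}$ with $f(u)\neq f(v)$ for every edge $uv$. For a vertex $v$, $N[v]$ denotes its closed neighborhood, and $f(S)=\{f(x):x\in S\}$. A lid-coloring of $G$ (not necessarily connected) is a proper coloring $f$ such that for every edge $uv$ with $N[u]\neq N[v]$ we have $f(N[u])\neq f(N[v])$; $\chi_{lid}(G)$ is the smallest number of colors in a lid-coloring of $G$. The tensor product $G\times H$ has vertex set $V(G)\times V(H)$, where $(u_1,v_1)$ and $(u_2,v_2)$ are adjacent iff $u_1u_2\in E(G)$ and $v_1v_2\in E(H)$. -}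

module Defs where

open import Level using (0ℓ)
open import Data.Nat using (ℕ; zero; suc; _∸_; _<_)
open import Data.Fin using (Fin; toℕ)
open import Data.Product using (Σ; _×_; _,_; ∃)
open import Data.Sum using (_⊎_)
open import Relation.Binary.PropositionalEquality using (_≡_; _≢_)
open import Relation.Nullary using (¬_)

record Graph : Set₁ where
  field
    V   : Set
    Adj : V → V → Set
open Graph public

N[_]∋_ : (G : Graph) → V G → V G → Set
(N[ G ]∋ v) x = x ≡ v ⊎ Adj G v x

ColN : (G : Graph) {k : ℕ} → (V G → Fin k) → V G → Fin k → Set
ColN G f v c = ∃ λ x → (N[ G ]∋ v) x × f x ≡ c

SameSet : {A : Set} → (A → Set) → (A → Set) → Set
SameSet {A} P Q = (a : A) → (P a → Q a) × (Q a → P a)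

IsProper : (G : Graph) {k : ℕ} → (V G → Fin k) → Set
IsProper G f = ∀ u v → Adj G u v → f u ≢ f v

IsLidColoring : (G : Graph) {k : ℕ} → (V G → Fin k) → Set
IsLidColoring G f =
  IsProper G f ×
  (∀ u v → Adj G u v → ¬ SameSet (N[ G ]∋ u) (N[ G ]∋ v) →
     ¬ SameSet (ColN G f u) (ColN G f v))

HasLidColoring : Graph → ℕ → Set
HasLidColoring G k = Σ (V G → Fin k) (IsLidColoring G)

χlid≡ : Graph → ℕ → Set
χlid≡ G k = HasLidColoring G k × (∀ j → j < k → ¬ HasLidColoring G j)

CycStep : (m : ℕ) → Fin m → Fin m → Set
CycStep m i j = toℕ j ≡ suc (toℕ i) ⊎ (toℕ i ≡ m ∸ 1 × toℕ j ≡ 0)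

C : ℕ → Graph
C m = record { V = Fin m ; Adj = λ i j → CycStep m i j ⊎ CycStep m j i }

_⊗_ : Graph → Graph → Graph
G ⊗ H = record
  { V   = V G × V H
  ; Adj = λ { (u₁ , v₁) (u₂ , v₂) → Adj G u₁ u₂ × Adj H v₁ v₂ } }

-- Let b be the even side. Colour every vertex of an even column 0 and every vertex of an odd
-- column 1 or 2. Edges join even to odd columns, so a vertex in an odd column sees only 0 and its
-- own colour, while a vertex in an even column sees 0 together with the colours of its four
-- neighbours; if each even-column vertex has neighbours of both colours 1 and 2, adjacent vertices
-- see different colour sets. When 4 ∣ b it suffices to alternate the odd columns 1, 2, 1, 2, ….
-- When b ≡ 2 (mod 4) the alternation breaks at one place, which is repaired by letting columns 1
-- and 3 depend on the row through a proper 3-colouring of the graph joining rows at distance two.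
-- Conversely, a proper colouring with at most two colours gives both ends of an edge the same
-- colour set, and C m × C n has edges whose ends have distinct closed neighbourhoods.
module Submission where

open import Defs
open import Data.Empty using (⊥-elim)
open import Data.Bool using (Bool; true; false; not; if_then_else_)
open import Data.Bool.Properties using (not-involutive)
open import Data.Fin using (Fin; toℕ; fromℕ; fromℕ<; _≟_)
open import Data.Fin.Patterns using (0F; 1F; 2F)
open import Data.Fin.Properties using (toℕ-fromℕ; toℕ-fromℕ<; toℕ<n)
open import Data.Nat using (ℕ; zero; suc; _≤_; _<_; _∸_; _*_; z≤n; s≤s; _<?_)
open import Data.Nat.Divisibility using (_∣_; divides)
open import Data.Nat.Properties
  using (≤-refl; ≤-trans; ≤-antisym; <-trans; <⇒≤; ≮⇒≥; ≤⇒≯; n<1+n; n≤1+n)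
open import Data.Product using (∃; ∃₂; _×_; _,_; proj₁; proj₂; swap)
open import Data.Sum using (_⊎_; inj₁; inj₂)
open import Function using (_∘_)
open import Relation.Nullary using (¬_; does; yes; no)
open import Relation.Nullary.Decidable using (dec-true; dec-false)
open import Relation.Binary.PropositionalEquality
  using (_≡_; _≢_; refl; sym; trans; cong; subst; subst₂)

isEven : ℕ → Bool
isEven zero          = true
isEven (suc zero)    = false
isEven (suc (suc n)) = isEven n

lowMod4 : ℕ → Bool
lowMod4 0 = true
lowMod4 1 = true
lowMod4 2 = false
lowMod4 3 = false
lowMod4 (suc (suc (suc (suc n)))) = lowMod4 n

isEven-suc : ∀ n → isEven (suc n) ≡ not (isEven n)
isEven-suc zero          = refl
isEven-suc (suc zero)    = refl
isEven-suc (suc (suc n)) = isEven-suc n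

isEven-suc⇒odd : ∀ n → isEven (suc n) ≡ true → isEven n ≢ true
isEven-suc⇒odd n e e′ = true≢false (trans (sym e) (trans (isEven-suc n) (cong not e′)))
  where
  true≢false : true ≢ false
  true≢false ()

isEven-*2 : ∀ q → isEven (q * 2) ≡ true
isEven-*2 zero    = refl
isEven-*2 (suc q) = isEven-*2 q

∣⇒isEven : ∀ {n} → 2 ∣ n → isEven n ≡ true
∣⇒isEven (divides q refl) = isEven-*2 q

lowMod4-+2 : ∀ n → lowMod4 (suc (suc n)) ≡ not (lowMod4 n)
lowMod4-+2 0 = refl
lowMod4-+2 1 = refl
lowMod4-+2 2 = refl
lowMod4-+2 3 = refl
lowMod4-+2 (suc (suc (suc (suc n)))) = lowMod4-+2 n

lowMod4-pred-even : ∀ n → isEven (suc n) ≡ true → lowMod4 n ≡ not (lowMod4 (suc n))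
lowMod4-pred-even 1 _ = refl
lowMod4-pred-even 3 _ = refl
lowMod4-pred-even (suc (suc (suc (suc n)))) e = lowMod4-pred-even n e

Step : ℕ → ℕ → ℕ → Set
Step m x y = y ≡ suc x ⊎ (x ≡ m ∸ 1 × y ≡ 0)

data CyclicNeighbours (m : ℕ) : ℕ → ℕ → ℕ → Set where
  first  : 2 ≤ m → CyclicNeighbours m 0 (m ∸ 1) 1
  last   : ∀ {k} → suc (suc k) ≡ m → CyclicNeighbours m (suc k) k 0
  middle : ∀ {k} → suc (suc k) < m → CyclicNeighbours m (suc k) k (suc (suc k))

∸1< : ∀ {m} → 2 ≤ m → m ∸ 1 < m
∸1< (s≤s _) = n<1+n _

adjacent-at : ∀ {m} (i : Fin m) {y} (y<m : y < m) → Step m (toℕ i) y ⊎ Step m y (toℕ i) →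
              ∃ λ i′ → Adj (C m) i i′ × toℕ i′ ≡ y
adjacent-at {m} i y<m step =
  fromℕ< y<m ,
  subst (λ y → Step m (toℕ i) y ⊎ Step m y (toℕ i)) (sym (toℕ-fromℕ< y<m)) step ,
  toℕ-fromℕ< y<m

neighbours : ∀ {m} → 2 ≤ m → (i : Fin m) →
             ∃₂ λ i₁ i₂ → Adj (C m) i i₁ × Adj (C m) i i₂ ×
                          CyclicNeighbours m (toℕ i) (toℕ i₁) (toℕ i₂)
neighbours {m} 2≤m i = go (toℕ i) refl (toℕ<n i)
  where
  pair : ∀ {x y z} → (∃ λ i₁ → Adj (C m) i i₁ × toℕ i₁ ≡ y) →
         (∃ λ i₂ → Adj (C m) i i₂ × toℕ i₂ ≡ z) → CyclicNeighbours m x y z →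
         ∃₂ λ i₁ i₂ → Adj (C m) i i₁ × Adj (C m) i i₂ × CyclicNeighbours m x (toℕ i₁) (toℕ i₂)
  pair (i₁ , a₁ , e₁) (i₂ , a₂ , e₂) nb =
    i₁ , i₂ , a₁ , a₂ , subst₂ (CyclicNeighbours m _) (sym e₁) (sym e₂) nb

  go : ∀ x → toℕ i ≡ x → x < m →
       ∃₂ λ i₁ i₂ → Adj (C m) i i₁ × Adj (C m) i i₂ × CyclicNeighbours m x (toℕ i₁) (toℕ i₂)
  go zero eq _ =
    pair (adjacent-at i (∸1< 2≤m) (inj₂ (inj₂ (refl , eq))))
         (adjacent-at i 2≤m (inj₁ (inj₁ (cong suc (sym eq)))))
         (first 2≤m)
  go (suc k) eq k<m with suc (suc k) <? m
  ... | yes 2+k<m =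
    pair (adjacent-at i (<-trans (n<1+n k) k<m) (inj₂ (inj₁ eq)))
         (adjacent-at i 2+k<m (inj₁ (inj₁ (cong suc (sym eq)))))
         (middle 2+k<m)
  ... | no 2+k≮m =
    pair (adjacent-at i (<-trans (n<1+n k) k<m) (inj₂ (inj₁ eq)))
         (adjacent-at i (≤-trans (s≤s z≤n) k<m) (inj₁ (inj₂ (trans eq (cong (_∸ 1) 2+k≡m) , refl))))
         (last 2+k≡m)
    where
    2+k≡m : suc (suc k) ≡ m
    2+k≡m = ≤-antisym k<m (≮⇒≥ 2+k≮m)

Step-flips-isEven : ∀ {m x y} → isEven (suc m) ≡ true → Step (suc m) x y →
                    isEven y ≡ not (isEven x)
Step-flips-isEven {x = x} _ (inj₁ refl)            = isEven-suc x
Step-flips-isEven {m} even (inj₂ (refl , refl)) = trans (sym even) (isEven-suc m)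

isEven-flips : ∀ {b} → isEven b ≡ true → {j j′ : Fin b} → Adj (C b) j j′ →
               isEven (toℕ j′) ≡ not (isEven (toℕ j))
isEven-flips {suc b} even (inj₁ step) = Step-flips-isEven even step
isEven-flips {suc b} even (inj₂ step) =
  trans (sym (not-involutive _)) (cong not (sym (Step-flips-isEven even step)))

-- A proper 3-colouring of the graph joining rows at cyclic distance two: rows are classed by
-- whether I mod 4 < 2, except that the last two rows get class 2 instead of 0.
rowClass : ℕ → ℕ → Fin 3
rowClass a I = if lowMod4 I then (if does (suc (suc I) <? a) then 0F else 2F) else 1F

rowClass-high : ∀ {a I} → lowMod4 I ≡ false → rowClass a I ≡ 1F
rowClass-high e rewrite e = refl

rowClass-low : ∀ {a I} → lowMod4 I ≡ true → suc (suc I) < a → rowClass a I ≡ 0F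
rowClass-low {a} {I} e lt rewrite e | dec-true (suc (suc I) <? a) lt = refl

rowClass-end : ∀ {a I} → a ≤ suc (suc I) → rowClass a I ≢ 0F
rowClass-end {a} {I} a≤ with lowMod4 I
... | false = λ ()
... | true rewrite dec-false (suc (suc I) <? a) (≤⇒≯ a≤) = λ ()

rowClass-low≢1 : ∀ {a I} → lowMod4 I ≡ true → rowClass a I ≢ 1F
rowClass-low≢1 {a} {I} e rewrite e with does (suc (suc I) <? a)
... | true  = λ ()
... | false = λ ()

rowClass-separates : ∀ {a x y z} → 3 ≤ a → CyclicNeighbours a x y z → rowClass a y ≢ rowClass a z
rowClass-separates {1} (s≤s ()) (first _)
rowClass-separates {2} (s≤s (s≤s ())) (first _)
rowClass-separates {3} _ (first _) = λ ()
rowClass-separates {a@(suc (suc (suc (suc a′))))} _ (first _) e =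
  rowClass-end {a} {suc (suc (suc a′))} (n≤1+n _)
    (trans e (rowClass-low {a} {1} refl (s≤s (s≤s (s≤s (s≤s z≤n))))))
rowClass-separates {a} {y = k} 3≤a (last refl) e =
  rowClass-end {a} {k} ≤-refl (trans e (rowClass-low {a} {0} refl 3≤a))
rowClass-separates {a} {y = k} _ (middle lt) = by-lowMod4 (lowMod4 k) refl
  where
  by-lowMod4 : ∀ v → lowMod4 k ≡ v → rowClass a k ≢ rowClass a (suc (suc k))
  by-lowMod4 true lo e =
    rowClass-low≢1 {a} {k} lo
      (trans e (rowClass-high {a} {suc (suc k)} (trans (lowMod4-+2 k) (cong not lo))))
  by-lowMod4 false lo e =
    rowClass-low≢1 {a} {suc (suc k)} (trans (lowMod4-+2 k) (cong not lo))
      (trans (sym e) (rowClass-high {a} {k} lo))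

avoiding : ∀ {a} → 3 ≤ a → (c : Fin 3) (i : Fin a) →
           ∃ λ i′ → Adj (C a) i i′ × rowClass a (toℕ i′) ≢ c
avoiding {a} 3≤a c i with neighbours (<⇒≤ 3≤a) i
... | i₁ , i₂ , adj₁ , adj₂ , nb with rowClass a (toℕ i₁) ≟ c
...   | yes e = i₂ , adj₂ , λ e₂ → rowClass-separates 3≤a nb (trans e (sym e₂))
...   | no ne = i₁ , adj₁ , ne

IsStrictLidColoring : (G : Graph) {k : ℕ} → (V G → Fin k) → Set
IsStrictLidColoring G f =
  IsProper G f × (∀ u v → Adj G u v → ¬ SameSet (ColN G f u) (ColN G f v))

strict⇒lid : ∀ {G k} {f : V G → Fin k} → IsStrictLidColoring G f → IsLidColoring G f
strict⇒lid (proper , separates) = proper , λ u v uv _ → separates u v uv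

ColN-only-self : ∀ {G} {f : V G → Fin 3} {v c} → (∀ x → Adj G v x → f x ≡ 0F) → c ≢ 0F →
                 ColN G f v c → f v ≡ c
ColN-only-self _     _   (_ , inj₁ refl , e) = e
ColN-only-self zeros c≢0 (x , inj₂ vx , e)   = ⊥-elim (c≢0 (trans (sym e) (zeros x vx)))

zero-sided-strict-lid : (G : Graph) (f : V G → Fin 3) →
  (∀ u v → Adj G u v → (f u ≡ 0F × f v ≢ 0F) ⊎ (f u ≢ 0F × f v ≡ 0F)) →
  (∀ u → f u ≡ 0F → ColN G f u 1F × ColN G f u 2F) →
  IsStrictLidColoring G f
zero-sided-strict-lid G f alternating sees-both = proper , separates
  where
  proper : IsProper G f
  proper u v uv e with alternating u v uv
  ... | inj₁ (u≡0 , v≢0) = v≢0 (trans (sym e) u≡0)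
  ... | inj₂ (u≢0 , v≡0) = u≢0 (trans e v≡0)

  around-nonzero : ∀ {v} → f v ≢ 0F → ∀ x → Adj G v x → f x ≡ 0F
  around-nonzero v≢0 x vx with alternating _ x vx
  ... | inj₁ (v≡0 , _) = ⊥-elim (v≢0 v≡0)
  ... | inj₂ (_ , x≡0) = x≡0

  distinguishes : ∀ {u v} → f u ≡ 0F → f v ≢ 0F → ¬ SameSet (ColN G f u) (ColN G f v)
  distinguishes {u} u≡0 v≢0 same
    with sees-both u u≡0
  ... | sees1 , sees2
    with trans (sym (ColN-only-self {G} (around-nonzero v≢0) (λ ()) (proj₁ (same 1F) sees1)))
               (ColN-only-self {G} (around-nonzero v≢0) (λ ()) (proj₁ (same 2F) sees2))
  ... | ()

  separates : ∀ u v → Adj G u v → ¬ SameSet (ColN G f u) (ColN G f v)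
  separates u v uv same with alternating u v uv
  ... | inj₁ (u≡0 , v≢0) = distinguishes u≡0 v≢0 same
  ... | inj₂ (u≢0 , v≡0) = distinguishes v≡0 u≢0 (λ c → swap (same c))

toneColour : Bool → Fin 3
toneColour v = if v then 1F else 2F

toneColour≢0 : ∀ v → toneColour v ≢ 0F
toneColour≢0 true  = λ ()
toneColour≢0 false = λ ()

Shows : ∀ {a} → (ℕ → ℕ → Bool) → Fin a → ℕ → Bool → Set
Shows {a} tone i y v = ∃ λ i′ → Adj (C a) i i′ × tone (toℕ i′) y ≡ v

module Torus {a b : ℕ} (tone : ℕ → ℕ → Bool) where

  colour : Fin a × Fin b → Fin 3
  colour (i , j) = if isEven (toℕ j) then 0F else toneColour (tone (toℕ i) (toℕ j))

  colour-even : ∀ i j → isEven (toℕ j) ≡ true → colour (i , j) ≡ 0F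
  colour-even i j e = cong (λ p → if p then 0F else toneColour (tone (toℕ i) (toℕ j))) e

  colour-odd : ∀ i j → isEven (toℕ j) ≡ false → colour (i , j) ≡ toneColour (tone (toℕ i) (toℕ j))
  colour-odd i j e = cong (λ p → if p then 0F else toneColour (tone (toℕ i) (toℕ j))) e

  colour≢0 : ∀ i j → isEven (toℕ j) ≡ false → colour (i , j) ≢ 0F
  colour≢0 i j odd = toneColour≢0 _ ∘ trans (sym (colour-odd i j odd))

  strict : 2 ≤ b → isEven b ≡ true →
           (∀ {x y z} → CyclicNeighbours b x y z → isEven x ≡ true →
              ∀ i v → Shows tone i y v ⊎ Shows tone i z v) →
           IsStrictLidColoring (C a ⊗ C b) colour
  strict 2≤b even shows = zero-sided-strict-lid (C a ⊗ C b) colour alternating sees-both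
    where
    flips : ∀ {j j′ p} → Adj (C b) j j′ → isEven (toℕ j) ≡ p → isEven (toℕ j′) ≡ not p
    flips jj′ e = trans (isEven-flips even jj′) (cong not e)

    alternating : ∀ u v → Adj (C a ⊗ C b) u v →
                  (colour u ≡ 0F × colour v ≢ 0F) ⊎ (colour u ≢ 0F × colour v ≡ 0F)
    alternating (i , j) (i′ , j′) (_ , jj′) = by-parity (isEven (toℕ j)) refl
      where
      by-parity : ∀ p → isEven (toℕ j) ≡ p →
                  (colour (i , j) ≡ 0F × colour (i′ , j′) ≢ 0F) ⊎
                  (colour (i , j) ≢ 0F × colour (i′ , j′) ≡ 0F)
      by-parity true  e = inj₁ (colour-even i j e , colour≢0 i′ j′ (flips jj′ e))
      by-parity false e = inj₂ (colour≢0 i j e , colour-even i′ j′ (flips jj′ e))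

    even-column : ∀ i j → colour (i , j) ≡ 0F → isEven (toℕ j) ≡ true
    even-column i j c≡0 = by-parity (isEven (toℕ j)) refl
      where
      by-parity : ∀ p → isEven (toℕ j) ≡ p → isEven (toℕ j) ≡ true
      by-parity true  e = e
      by-parity false e = ⊥-elim (colour≢0 i j e c≡0)

    seen : ∀ {i j j′ v} → isEven (toℕ j) ≡ true → Adj (C b) j j′ → Shows tone i (toℕ j′) v →
           ColN (C a ⊗ C b) colour (i , j) (toneColour v)
    seen {j′ = j′} even-j jj′ (i′ , ii′ , t) =
      (i′ , j′) , inj₂ (ii′ , jj′) , trans (colour-odd i′ j′ (flips jj′ even-j)) (cong toneColour t)

    sees : ∀ {i j} → isEven (toℕ j) ≡ true → ∀ v → ColN (C a ⊗ C b) colour (i , j) (toneColour v)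
    sees {i} {j} even-j v with neighbours 2≤b j
    ... | _ , _ , jj₁ , jj₂ , nb with shows nb even-j i v
    ...   | inj₁ s = seen even-j jj₁ s
    ...   | inj₂ s = seen even-j jj₂ s

    sees-both : ∀ u → colour u ≡ 0F → ColN (C a ⊗ C b) colour u 1F × ColN (C a ⊗ C b) colour u 2F
    sees-both (i , j) c≡0 =
      sees {i} (even-column i j c≡0) true , sees {i} (even-column i j c≡0) false

p≡v⊎not-p≡v : ∀ p v → p ≡ v ⊎ not p ≡ v
p≡v⊎not-p≡v true  true  = inj₁ refl
p≡v⊎not-p≡v true  false = inj₂ refl
p≡v⊎not-p≡v false true  = inj₂ refl
p≡v⊎not-p≡v false false = inj₁ refl

shows-alternating : ∀ {a} (tone : ℕ → ℕ → Bool) {y z} → 2 ≤ a → (∀ I → tone I z ≡ not (tone I y)) →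
                    (i : Fin a) (v : Bool) → Shows tone i y v ⊎ Shows tone i z v
shows-alternating tone {y} 2≤a alternate i v with neighbours 2≤a i
... | i′ , _ , ii′ , _ , _ with p≡v⊎not-p≡v (tone (toℕ i′) y) v
...   | inj₁ e = inj₁ (i′ , ii′ , e)
...   | inj₂ e = inj₂ (i′ , ii′ , trans (alternate _) e)

stripes : ℕ → ℕ → Bool
stripes _ J = lowMod4 J

stripes-alternate : ∀ {b x y z} → isEven b ≡ true → lowMod4 b ≡ true →
                    CyclicNeighbours b x y z → isEven x ≡ true → lowMod4 z ≡ not (lowMod4 y)
stripes-alternate {suc b} even low (first _) _ =
  sym (cong not (trans (lowMod4-pred-even b even) (cong not low)))
stripes-alternate even _ (last {k} refl) even-x = ⊥-elim (isEven-suc⇒odd k even-x even)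
stripes-alternate _    _ (middle {k} _)  _      = lowMod4-+2 k

patched : ℕ → ℕ → ℕ → Bool
patched a I 1 = does (rowClass a I ≟ 0F)
patched a I 3 = does (rowClass a I ≟ 1F)
patched a I J = lowMod4 J

patched-last-column : ∀ {b} → 3 ≤ b → isEven b ≡ true → lowMod4 b ≡ false →
                      ∀ a I → patched a I (b ∸ 1) ≡ true
patched-last-column {suc (suc (suc (suc (suc (suc b)))))} _ even low _ _ =
  trans (lowMod4-pred-even (suc (suc (suc (suc (suc b))))) even) (cong not low)
patched-last-column {2} (s≤s (s≤s ())) _ _
patched-last-column {3} _ () _
patched-last-column {4} _ _ ()
patched-last-column {5} _ () _

Fin3-remaining : (c : Fin 3) → c ≢ 0F → c ≢ 2F → c ≡ 1F
Fin3-remaining 0F c≢0 _   = ⊥-elim (c≢0 refl)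
Fin3-remaining 1F _   _   = refl
Fin3-remaining 2F _   c≢2 = ⊥-elim (c≢2 refl)

patched-shows : ∀ {a b x y z} → 3 ≤ a → 3 ≤ b → isEven b ≡ true → lowMod4 b ≡ false →
                CyclicNeighbours b x y z → isEven x ≡ true →
                (i : Fin a) (v : Bool) → Shows (patched a) i y v ⊎ Shows (patched a) i z v
patched-shows {a} 3≤a 3≤b even low (first _) _ i true
  with neighbours (<⇒≤ 3≤a) i
... | i′ , _ , ii′ , _ , _ = inj₁ (i′ , ii′ , patched-last-column 3≤b even low a (toℕ i′))
patched-shows {a} 3≤a _ _ _ (first _) _ i false
  with avoiding 3≤a 0F i
... | i′ , ii′ , ≢0 = inj₂ (i′ , ii′ , dec-false (rowClass a (toℕ i′) ≟ 0F) ≢0)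
patched-shows _ _ even _ (last {k} refl) even-x _ _ = ⊥-elim (isEven-suc⇒odd k even-x even)
patched-shows {a} 3≤a _ _ _ (middle {1} _) _ i true
  with avoiding 3≤a 2F i
... | i′ , ii′ , ≢2 with rowClass a (toℕ i′) ≟ 0F
...   | yes ≡0 = inj₁ (i′ , ii′ , dec-true (rowClass a (toℕ i′) ≟ 0F) ≡0)
...   | no ≢0  = inj₂ (i′ , ii′ , dec-true (rowClass a (toℕ i′) ≟ 1F) (Fin3-remaining _ ≢0 ≢2))
patched-shows {a} 3≤a _ _ _ (middle {1} _) _ i false
  with avoiding 3≤a 0F i
... | i′ , ii′ , ≢0 = inj₁ (i′ , ii′ , dec-false (rowClass a (toℕ i′) ≟ 0F) ≢0)
patched-shows {a} 3≤a _ _ _ (middle {3} _) _ i true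
  with neighbours (<⇒≤ 3≤a) i
... | i′ , _ , ii′ , _ , _ = inj₂ (i′ , ii′ , refl)
patched-shows {a} 3≤a _ _ _ (middle {3} _) _ i false
  with avoiding 3≤a 1F i
... | i′ , ii′ , ≢1 = inj₁ (i′ , ii′ , dec-false (rowClass a (toℕ i′) ≟ 1F) ≢1)
patched-shows {a} 3≤a _ _ _ (middle {suc (suc (suc (suc k)))} _) _ =
  shows-alternating (patched a) {suc (suc (suc (suc k)))} {suc (suc (suc (suc (suc (suc k)))))}
    (<⇒≤ 3≤a) (λ _ → lowMod4-+2 (suc (suc (suc (suc k)))))

torus-strict : ∀ {a b} → 3 ≤ a → 3 ≤ b → isEven b ≡ true →
               ∃ λ (f : Fin a × Fin b → Fin 3) → IsStrictLidColoring (C a ⊗ C b) f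
torus-strict {a} {b} 3≤a 3≤b even with lowMod4 b in low
... | true  = Torus.colour stripes ,
              Torus.strict stripes (<⇒≤ 3≤b) even
                λ {_} {y} {z} nb even-x →
                  shows-alternating stripes {y} {z} (<⇒≤ 3≤a)
                    (λ _ → stripes-alternate even low nb even-x)
... | false = Torus.colour (patched a) ,
              Torus.strict (patched a) (<⇒≤ 3≤b) even (patched-shows 3≤a 3≤b even low)

ColN-⊗-swap : ∀ {G H k} {f : V G × V H → Fin k} {u c} →
              ColN (G ⊗ H) f u c → ColN (H ⊗ G) (f ∘ swap) (swap u) c
ColN-⊗-swap (x , inj₁ refl , e)       = swap x , inj₁ refl , e
ColN-⊗-swap (x , inj₂ (a₁ , a₂) , e) = swap x , inj₂ (a₂ , a₁) , e

strict-⊗-swap : ∀ {G H k} {f : V G × V H → Fin k} →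
                IsStrictLidColoring (G ⊗ H) f → IsStrictLidColoring (H ⊗ G) (f ∘ swap)
strict-⊗-swap {G} {H} {f = f} (proper , separates) =
  (λ u v (a₁ , a₂) → proper (swap u) (swap v) (a₂ , a₁)) ,
  λ u v (a₁ , a₂) same → separates (swap u) (swap v) (a₂ , a₁) λ c →
    (ColN-⊗-swap {H} {G} ∘ proj₁ (same c) ∘ ColN-⊗-swap {G} {H} {f = f}) ,
    (ColN-⊗-swap {H} {G} ∘ proj₂ (same c) ∘ ColN-⊗-swap {G} {H} {f = f})

Fin2-cover : (x y : Fin 2) → x ≢ y → ∀ c → c ≡ x ⊎ c ≡ y
Fin2-cover 0F 0F x≢y _  = ⊥-elim (x≢y refl)
Fin2-cover 0F 1F _   0F = inj₁ refl
Fin2-cover 0F 1F _   1F = inj₂ refl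
Fin2-cover 1F 0F _   0F = inj₂ refl
Fin2-cover 1F 0F _   1F = inj₁ refl
Fin2-cover 1F 1F x≢y _  = ⊥-elim (x≢y refl)

lid-needs-three : (G : Graph) {u v : V G} → Adj G u v → Adj G v u →
                  ¬ SameSet (N[ G ]∋ u) (N[ G ]∋ v) → ∀ k → k < 3 → ¬ HasLidColoring G k
lid-needs-three G {u} _ _ _ 0 _ (f , _) with f u
... | ()
lid-needs-three G {u} {v} uv _ _ 1 _ (f , proper , _) = proper u v uv (Fin1-≡ (f u) (f v))
  where
  Fin1-≡ : (x y : Fin 1) → x ≡ y
  Fin1-≡ 0F 0F = refl
lid-needs-three G {u} {v} uv vu distinct 2 _ (f , proper , separates) =
  separates u v uv distinct λ c → (λ _ → sees-all vu (proper u v uv ∘ sym) c) ,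
                                  (λ _ → sees-all uv (proper u v uv) c)
  where
  sees-all : ∀ {w w′} → Adj G w w′ → f w ≢ f w′ → ∀ c → ColN G f w c
  sees-all {w} {w′} ww′ ne c with Fin2-cover (f w) (f w′) ne c
  ... | inj₁ e = w  , inj₁ refl , sym e
  ... | inj₂ e = w′ , inj₂ ww′  , sym e
lid-needs-three _ _ _ _ (suc (suc (suc _))) (s≤s (s≤s (s≤s ())))

-- (0,0) ~ (1,1), while (1, n-1) is a neighbour of (0,0) but not of (1,1).
torus-lid≥3 : ∀ {m n} → 3 ≤ m → 3 ≤ n → ∀ k → k < 3 → ¬ HasLidColoring (C m ⊗ C n) k
torus-lid≥3 {n = suc (suc (suc n))} (s≤s (s≤s (s≤s _))) (s≤s (s≤s (s≤s _))) =
  lid-needs-three (C _ ⊗ C _) {0F , 0F} {1F , 1F}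
    (inj₁ (inj₁ refl) , inj₁ (inj₁ refl)) (inj₂ (inj₁ refl) , inj₂ (inj₁ refl)) distinct
  where
  lastCol : Fin (suc (suc (suc n)))
  lastCol = fromℕ (suc (suc n))

  distinct : ¬ SameSet (N[ C _ ⊗ C _ ]∋ (0F , 0F)) (N[ C _ ⊗ C _ ]∋ (1F , 1F))
  distinct same
    with proj₁ (same (1F , lastCol)) (inj₂ (inj₁ (inj₁ refl) , inj₂ (inj₂ (toℕ-fromℕ _ , refl))))
  ... | inj₁ e with trans (sym (toℕ-fromℕ (suc (suc n)))) (cong (toℕ ∘ proj₂) e)
  ...   | ()
  distinct same | inj₂ (inj₁ (inj₁ ()) , _)
  distinct same | inj₂ (inj₁ (inj₂ (_ , ())) , _)
  distinct same | inj₂ (inj₂ (inj₁ ()) , _)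
  distinct same | inj₂ (inj₂ (inj₂ (_ , ())) , _)

torus-strict-lid : ∀ {m n} → 3 ≤ m → 3 ≤ n → 2 ∣ m ⊎ 2 ∣ n →
                   ∃ λ (f : Fin m × Fin n → Fin 3) → IsStrictLidColoring (C m ⊗ C n) f
torus-strict-lid 3≤m 3≤n (inj₂ 2∣n) = torus-strict 3≤m 3≤n (∣⇒isEven 2∣n)
torus-strict-lid 3≤m 3≤n (inj₁ 2∣m) with torus-strict 3≤n 3≤m (∣⇒isEven 2∣m)
... | f , strict = f ∘ swap , strict-⊗-swap strict

lemma19 : (m n : ℕ) → 3 ≤ m → m ≤ n → (2 ∣ m ⊎ 2 ∣ n) → χlid≡ (C m ⊗ C n) 3
lemma19 m n 3≤m m≤n even =
  let f , strict = torus-strict-lid 3≤m 3≤n even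
  in (f , strict⇒lid strict) , torus-lid≥3 3≤m 3≤n
  where
  3≤n : 3 ≤ n
  3≤n = ≤-trans 3≤m m≤n
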